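{- Let $r$, $s$, and $n$ be integers satisfying $1<r$, $1<s$, $r\le n$, $s\le n$, and $n<r+s$. Let $G$ be a graph containing an $s$-clique $A$ and an $r$-clique $B$ with $A$ and $B$ disjoint, such that each vertex in $B$ is adjacent to at least $j$ vertices in $A$. Then \[ N(G,n)\le \left\lfloor\frac{r(s-j)}{r+s-n}\right\rfloor. \]
   Context: All graphs are finite simple graphs. An $r$-clique is a set of $r$ pairwise adjacent vertices. An $n$-coloring of a graph $G$ is a proper vertex coloring using at most $n$ colors. Two colorings $C_1,C_2$ of $G$ are orthogonal if whenever two distinct vertices share a color in $C_1$, they have distinct colors in $C_2$. $N(G,n)$ denotes the maximum size of a set of pairwise orthogonal $n$-colorings of $G$. -}

module Defs where

open import Data.Nat using (ℕ; _+_; _*_; _∸_; _<_; _≤_; >-nonZero)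
open import Data.Nat.DivMod using (_/_)
open import Data.Nat.Properties using (m<n⇒0<n∸m)
open import Data.Fin using (Fin)
open import Data.Empty using (⊥)
open import Relation.Nullary using (¬_)
open import Relation.Binary.PropositionalEquality using (_≡_; _≢_)
open import Function.Definitions using (Injective)
open import Data.Product using (Σ; ∃; _×_)

record Graph : Set₁ where
  field
    V     : ℕ
    Adj   : Fin V → Fin V → Set
    sym   : ∀ {u v} → Adj u v → Adj v u
    irrefl : ∀ {v} → ¬ Adj v v
open Graph public

IsClique : (G : Graph) (r : ℕ) → (Fin r → Fin (V G)) → Set
IsClique G r A = Injective _≡_ _≡_ A × (∀ i k → i ≢ k → Adj G (A i) (A k))

IsColoring : (G : Graph) (n : ℕ) → (Fin (V G) → Fin n) → Set
IsColoring G n c = ∀ {u v} → Adj G u v → c u ≢ c v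

Orthogonal : (G : Graph) (n : ℕ) → (Fin (V G) → Fin n) → (Fin (V G) → Fin n) → Set
Orthogonal G n c₁ c₂ = ∀ u v → u ≢ v → c₁ u ≡ c₁ v → c₂ u ≢ c₂ v

OrthogonalSet : (G : Graph) (n k : ℕ) → Set
OrthogonalSet G n k =
  Σ (Fin k → Fin (V G) → Fin n) λ C →
      (∀ i → IsColoring G n (C i))
    × (∀ i i′ → i ≢ i′ → ¬ (∀ v → C i v ≡ C i′ v))
    × (∀ i i′ → i ≢ i′ → Orthogonal G n (C i) (C i′))

-- N(G,n) ≤ b  :  every set of pairwise orthogonal n-colourings has size ≤ b
-- (N(G,n) is the maximum such size, so this is exactly N(G,n) ≤ b).
N≤ : (G : Graph) (n b : ℕ) → Set
N≤ G n b = ∀ k → OrthogonalSet G n k → k ≤ b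

bound : (r s j n : ℕ) → n < r + s → ℕ
bound r s j n h = _/_ (r * (s ∸ j)) (r + s ∸ n) {{>-nonZero (m<n⇒0<n∸m h)}}

module Submission where

-- Proof by double counting.  Fix k pairwise orthogonal proper n-colourings
-- C₀ … C_{k-1} of G and count the triples (i, a, b) with Cᵢ(A a) = Cᵢ(B b).
--
--  * Lower bound.  A proper colouring is injective on each clique, so it maps
--    A and B injectively into the n colours; two injections of an s-set and an
--    r-set into an n-set have at least r + s − n coincidences
--    ('coincidences-lower-bound').  Hence the count is ≥ k (r + s − n).
--  * Upper bound.  For fixed a, b the vertices A a ≠ B b share a colour in at
--    most one Cᵢ (orthogonality), and in none if they are adjacent (properness).
--    As B b has ≥ j neighbours in A, each b contributes ≤ s − j.
--    Hence the count is ≤ r (s − j).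

open import Defs hiding (sym)
open import Data.Nat using (ℕ; _<_; _≤_; _+_; _*_; _∸_; zero; suc; z≤n; s≤s; NonZero; >-nonZero)
open import Data.Nat.Properties hiding (_≟_)
open import Data.Nat.DivMod using (_/_; m*n/n≡m; /-monoˡ-≤)
open import Data.Fin using (Fin; zero; suc)
open import Data.Fin.Properties using (_≟_) renaming (suc-injective to Fin-suc-injective)
open import Data.Product using (Σ; _×_; _,_; ∃)
open import Relation.Nullary using (yes; no)
open import Relation.Nullary.Negation using (contradiction)
open import Function using (_∘_)
open import Function.Definitions using (Injective)
open import Relation.Binary.PropositionalEquality
open import Algebra.Properties.Semiring.Sum +-*-semiring
  using (sum; sum-syntax; sum-cong-≗; ∑-comm; ∑-distrib-+; *-distribʳ-sum)

sum-const : ∀ n c → ∑[ i < n ] c ≡ n * c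
sum-const zero    c = refl
sum-const (suc n) c = cong (c +_) (sum-const n c)

sum-mono : ∀ {n} {f g : Fin n → ℕ} → (∀ i → f i ≤ g i) → sum f ≤ sum g
sum-mono {zero}  f≤g = z≤n
sum-mono {suc n} f≤g = +-mono-≤ (f≤g zero) (sum-mono (f≤g ∘ suc))

sum-zero : ∀ {n} {f : Fin n → ℕ} → (∀ i → f i ≡ 0) → sum f ≡ 0
sum-zero {n} f≡0 = trans (sum-cong-≗ f≡0) (trans (sum-const n 0) (*-zeroʳ n))

sum-positive : ∀ {n} (f : Fin n → ℕ) → 0 < sum f → ∃ λ i → 0 < f i
sum-positive {suc n} f 0<∑ with f zero in f₀≡
... | suc _ = zero , subst (0 <_) (sym f₀≡) (s≤s z≤n)
... | zero with sum-positive (f ∘ suc) 0<∑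
...   | i , 0<fᵢ = suc i , 0<fᵢ

sum-atMostOne : ∀ {n} (f : Fin n → ℕ) → (∀ i → f i ≤ 1) →
                (∀ i i′ → 0 < f i → 0 < f i′ → i ≡ i′) → sum f ≤ 1
sum-atMostOne {zero}  f f≤1 unique = z≤n
sum-atMostOne {suc n} f f≤1 unique with f zero in f₀≡
... | zero  = sum-atMostOne (f ∘ suc) (f≤1 ∘ suc)
                (λ i i′ p q → Fin-suc-injective (unique (suc i) (suc i′) p q))
... | suc m = begin
  suc m + sum (f ∘ suc) ≡⟨ cong (suc m +_) (sum-zero tail≡0) ⟩
  suc m + 0             ≡⟨ +-identityʳ (suc m) ⟩
  suc m                 ≡⟨ f₀≡ ⟨
  f zero                ≤⟨ f≤1 zero ⟩
  1                     ∎
  where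
  open ≤-Reasoning
  tail≡0 : ∀ i → f (suc i) ≡ 0
  tail≡0 i with f (suc i) in fᵢ≡
  ... | zero  = refl
  ... | suc _ with unique zero (suc i) (subst (0 <_) (sym f₀≡) (s≤s z≤n))
                                       (subst (0 <_) (sym fᵢ≡) (s≤s z≤n))
  ...   | ()

δ : ∀ {n} → Fin n → Fin n → ℕ
δ zero    zero    = 1
δ zero    (suc _) = 0
δ (suc _) zero    = 0
δ (suc x) (suc y) = δ x y

δ≤1 : ∀ {n} (x y : Fin n) → δ x y ≤ 1
δ≤1 zero    zero    = s≤s z≤n
δ≤1 zero    (suc y) = z≤n
δ≤1 (suc x) zero    = z≤n
δ≤1 (suc x) (suc y) = δ≤1 x y

δ-positive⇒≡ : ∀ {n} (x y : Fin n) → 0 < δ x y → x ≡ y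
δ-positive⇒≡ zero    zero    _   = refl
δ-positive⇒≡ (suc x) (suc y) 0<δ = cong suc (δ-positive⇒≡ x y 0<δ)

δ-≢ : ∀ {n} (x y : Fin n) → x ≢ y → δ x y ≡ 0
δ-≢ x y x≢y = n≤0⇒n≡0 (≮⇒≥ (x≢y ∘ δ-positive⇒≡ x y))

δ-sift : ∀ {n} (u : Fin n) (w : Fin n → ℕ) → ∑[ x < n ] (δ u x * w x) ≡ w u
δ-sift {suc n} zero    w = begin
  w zero + 0 + sum (λ x → δ zero (suc x) * w (suc x)) ≡⟨ cong (w zero + 0 +_) (sum-zero {n} (λ _ → refl)) ⟩
  w zero + 0 + 0                                       ≡⟨ +-identityʳ _ ⟩
  w zero + 0                                           ≡⟨ +-identityʳ _ ⟩
  w zero                                               ∎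
  where open ≡-Reasoning
δ-sift {suc n} (suc u) w = δ-sift u (w ∘ suc)

fibre : ∀ {m n} → (Fin m → Fin n) → Fin n → ℕ
fibre {m} h x = ∑[ a < m ] δ (h a) x

fibre-weighted : ∀ {m n} (h : Fin m → Fin n) (w : Fin n → ℕ) →
                 ∑[ x < n ] (fibre h x * w x) ≡ ∑[ a < m ] w (h a)
fibre-weighted {m} {n} h w = begin
  ∑[ x < n ] (fibre h x * w x)         ≡⟨ sum-cong-≗ (λ x → *-distribʳ-sum (w x) (λ a → δ (h a) x)) ⟩
  ∑[ x < n ] ∑[ a < m ] (δ (h a) x * w x) ≡⟨ ∑-comm (λ x a → δ (h a) x * w x) ⟩
  ∑[ a < m ] ∑[ x < n ] (δ (h a) x * w x) ≡⟨ sum-cong-≗ (λ a → δ-sift (h a) w) ⟩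
  ∑[ a < m ] w (h a)                   ∎
  where open ≡-Reasoning

fibres-total : ∀ {m n} (h : Fin m → Fin n) → ∑[ x < n ] fibre h x ≡ m
fibres-total {m} {n} h = begin
  ∑[ x < n ] fibre h x       ≡⟨ sum-cong-≗ (λ x → *-identityʳ (fibre h x)) ⟨
  ∑[ x < n ] (fibre h x * 1) ≡⟨ fibre-weighted h (λ _ → 1) ⟩
  ∑[ a < m ] 1               ≡⟨ sum-const m 1 ⟩
  m * 1                      ≡⟨ *-identityʳ m ⟩
  m                          ∎
  where open ≡-Reasoning

fibre-injective : ∀ {m n} (h : Fin m → Fin n) → Injective _≡_ _≡_ h → ∀ x → fibre h x ≤ 1
fibre-injective h h-inj x = sum-atMostOne _ (λ a → δ≤1 (h a) x)
  (λ a a′ p q → h-inj (trans (δ-positive⇒≡ (h a) x p) (sym (δ-positive⇒≡ (h a′) x q))))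

fibre-positive : ∀ {m n} (h : Fin m → Fin n) x → 0 < fibre h x → ∃ λ a → h a ≡ x
fibre-positive h x 0<fib with sum-positive (λ a → δ (h a) x) 0<fib
... | a , 0<δ = a , δ-positive⇒≡ (h a) x 0<δ

unhit-count : ∀ {j s} (f : Fin j → Fin s) → Injective _≡_ _≡_ f →
              ∑[ a < s ] (1 ∸ fibre f a) ≡ s ∸ j
unhit-count {j} {s} f f-inj = begin
  ∑[ a < s ] (1 ∸ fibre f a)                        ≡⟨ m+n∸n≡m _ j ⟨
  ∑[ a < s ] (1 ∸ fibre f a) + j ∸ j                ≡⟨ cong (λ t → ∑[ a < s ] (1 ∸ fibre f a) + t ∸ j) (fibres-total f) ⟨
  ∑[ a < s ] (1 ∸ fibre f a) + ∑[ a < s ] fibre f a ∸ j ≡⟨ cong (_∸ j) (∑-distrib-+ (λ a → 1 ∸ fibre f a) (fibre f)) ⟨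
  ∑[ a < s ] (1 ∸ fibre f a + fibre f a) ∸ j        ≡⟨ cong (_∸ j) (sum-cong-≗ (λ a → m∸n+n≡m (fibre-injective f f-inj a))) ⟩
  ∑[ a < s ] 1 ∸ j                                  ≡⟨ cong (_∸ j) (trans (sum-const s 1) (*-identityʳ s)) ⟩
  s ∸ j                                             ∎
  where open ≡-Reasoning

coincidences : ∀ {r s n} → (Fin s → Fin n) → (Fin r → Fin n) → ℕ
coincidences {r} α β = ∑[ b < r ] fibre α (β b)

sum≤1+product : ∀ {q p} → q ≤ 1 → p ≤ 1 → q + p ≤ 1 + q * p
sum≤1+product z≤n       z≤n       = z≤n
sum≤1+product z≤n       (s≤s z≤n) = s≤s z≤n
sum≤1+product (s≤s z≤n) z≤n       = s≤s z≤n
sum≤1+product (s≤s z≤n) (s≤s z≤n) = s≤s (s≤s z≤n)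

-- Injections of an s-set and an r-set into an n-set coincide at least
-- r + s − n times: every colour x is hit by B at most once and by A at most
-- once, and only a colour hit by both can be counted twice.
coincidences-lower-bound : ∀ {r s n} (α : Fin s → Fin n) (β : Fin r → Fin n) →
  Injective _≡_ _≡_ α → Injective _≡_ _≡_ β → r + s ≤ n + coincidences α β
coincidences-lower-bound {r} {s} {n} α β α-inj β-inj = begin
  r + s                                          ≡⟨ cong₂ _+_ (fibres-total β) (fibres-total α) ⟨
  ∑[ x < n ] fibre β x + ∑[ x < n ] fibre α x    ≡⟨ ∑-distrib-+ (fibre β) (fibre α) ⟨
  ∑[ x < n ] (fibre β x + fibre α x)             ≤⟨ sum-mono (λ x → sum≤1+product (fibre-injective β β-inj x) (fibre-injective α α-inj x)) ⟩
  ∑[ x < n ] (1 + fibre β x * fibre α x)         ≡⟨ ∑-distrib-+ (λ _ → 1) (λ x → fibre β x * fibre α x) ⟩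
  ∑[ x < n ] 1 + ∑[ x < n ] (fibre β x * fibre α x) ≡⟨ cong₂ _+_ (trans (sum-const n 1) (*-identityʳ n)) (fibre-weighted β (fibre α)) ⟩
  n + coincidences α β                           ∎
  where open ≤-Reasoning

colouring-injective-on-clique : ∀ G {n m} {c : Fin (V G) → Fin n} {X : Fin m → Fin (V G)} →
  IsColoring G n c → IsClique G m X → Injective _≡_ _≡_ (c ∘ X)
colouring-injective-on-clique G c-proper (_ , X-adj) {a} {a′} same-colour with a ≟ a′
... | yes a≡a′ = a≡a′
... | no  a≢a′ = contradiction same-colour (c-proper (X-adj a a′ a≢a′))

clique-coincidences : ∀ G {r s n} {c : Fin (V G) → Fin n}
  {A : Fin s → Fin (V G)} {B : Fin r → Fin (V G)} →
  IsColoring G n c → IsClique G s A → IsClique G r B →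
  r + s ∸ n ≤ coincidences (c ∘ A) (c ∘ B)
clique-coincidences G {r} {s} {n} {c} {A} {B} c-proper A-clique B-clique =
  subst (r + s ∸ n ≤_) (m+n∸m≡n n _) (∸-monoˡ-≤ n
    (coincidences-lower-bound (c ∘ A) (c ∘ B)
      (colouring-injective-on-clique G c-proper A-clique)
      (colouring-injective-on-clique G c-proper B-clique)))

module OrthogonalFamily (G : Graph) {n k : ℕ} (C : Fin k → Fin (V G) → Fin n)
  (proper : ∀ i → IsColoring G n (C i))
  (orthogonal : ∀ i i′ → i ≢ i′ → Orthogonal G n (C i) (C i′)) where

  agreements : Fin (V G) → Fin (V G) → ℕ
  agreements u v = ∑[ i < k ] δ (C i u) (C i v)

  agreements≤1 : ∀ {u v} → u ≢ v → agreements u v ≤ 1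
  agreements≤1 {u} {v} u≢v = sum-atMostOne _ (λ i → δ≤1 (C i u) (C i v)) same-member
    where
    same-member : ∀ i i′ → 0 < δ (C i u) (C i v) → 0 < δ (C i′ u) (C i′ v) → i ≡ i′
    same-member i i′ p q with i ≟ i′
    ... | yes i≡i′ = i≡i′
    ... | no  i≢i′ = contradiction (δ-positive⇒≡ _ _ q)
                       (orthogonal i i′ i≢i′ u v u≢v (δ-positive⇒≡ _ _ p))

  agreements-adjacent : ∀ {u v} → Adj G u v → agreements u v ≡ 0
  agreements-adjacent adj = sum-zero (λ i → δ-≢ _ _ (proper i adj))

  agreements-outside : ∀ {s j} (A : Fin s → Fin (V G)) {v} → (∀ a → A a ≢ v) →
    (Σ (Fin j → Fin s) λ f → Injective _≡_ _≡_ f × (∀ t → Adj G v (A (f t)))) →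
    ∑[ a < s ] agreements (A a) v ≤ s ∸ j
  agreements-outside {s} {j} A {v} outside (f , f-inj , adj) = begin
    ∑[ a < s ] agreements (A a) v ≤⟨ sum-mono pair-bound ⟩
    ∑[ a < s ] (1 ∸ fibre f a)    ≡⟨ unhit-count f f-inj ⟩
    s ∸ j                         ∎
    where
    open ≤-Reasoning
    -- the neighbours A (f t) contribute nothing, the others at most one each
    pair-bound : ∀ a → agreements (A a) v ≤ 1 ∸ fibre f a
    pair-bound a with fibre f a in fib≡
    ... | zero  = agreements≤1 (outside a)
    ... | suc _ with fibre-positive f a (subst (0 <_) (sym fib≡) (s≤s z≤n))
    ...   | t , refl = ≤-trans (≤-reflexive (agreements-adjacent (Graph.sym G (adj t)))) z≤n

  total-coincidences : ∀ {r s} (A : Fin s → Fin (V G)) (B : Fin r → Fin (V G)) →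
    ∑[ i < k ] coincidences (C i ∘ A) (C i ∘ B) ≡ ∑[ b < r ] ∑[ a < s ] agreements (A a) (B b)
  total-coincidences {r} {s} A B = begin
    ∑[ i < k ] ∑[ b < r ] ∑[ a < s ] δ (C i (A a)) (C i (B b)) ≡⟨ ∑-comm (λ i b → ∑[ a < s ] δ (C i (A a)) (C i (B b))) ⟩
    ∑[ b < r ] ∑[ i < k ] ∑[ a < s ] δ (C i (A a)) (C i (B b)) ≡⟨ sum-cong-≗ (λ b → ∑-comm (λ i a → δ (C i (A a)) (C i (B b)))) ⟩
    ∑[ b < r ] ∑[ a < s ] agreements (A a) (B b)               ∎
    where open ≡-Reasoning

≤-quotient : ∀ {k m} d .{{_ : NonZero d}} → k * d ≤ m → k ≤ m / d
≤-quotient {k} d kd≤m = subst (_≤ _) (m*n/n≡m k d) (/-monoˡ-≤ d kd≤m)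

theorem1p2 : (r s n j : ℕ) → 1 < r → 1 < s → r ≤ n → s ≤ n → (h : n < r + s) →
    (G : Graph) → (A : Fin s → Fin (V G)) → (B : Fin r → Fin (V G)) →
    IsClique G s A → IsClique G r B →
    (∀ a b → A a ≢ B b) →
    (∀ b → Σ (Fin j → Fin s) λ f → Injective _≡_ _≡_ f × (∀ i → Adj G (B b) (A (f i)))) →
    N≤ G n (bound r s j n h)
theorem1p2 r s n j _ _ _ _ h G A B A-clique B-clique disjoint neighbours k (C , proper , _ , orthogonal) =
  ≤-quotient d {{>-nonZero (m<n⇒0<n∸m h)}} (begin
    k * d                                        ≡⟨ sum-const k d ⟨
    ∑[ i < k ] d                                 ≤⟨ sum-mono (λ i → clique-coincidences G (proper i) A-clique B-clique) ⟩
    ∑[ i < k ] coincidences (C i ∘ A) (C i ∘ B)  ≡⟨ total-coincidences A B ⟩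
    ∑[ b < r ] ∑[ a < s ] agreements (A a) (B b) ≤⟨ sum-mono (λ b → agreements-outside A (λ a → disjoint a b) (neighbours b)) ⟩
    ∑[ b < r ] (s ∸ j)                           ≡⟨ sum-const r (s ∸ j) ⟩
    r * (s ∸ j)                                  ∎)
  where
  open ≤-Reasoning
  open OrthogonalFamily G C proper orthogonal
  d : ℕ
  d = r + s ∸ n
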